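{- Let $N\in\{1,2,67,163\}$ and let $d$ be a positive integer. For each solution $v$ of $v^2+N\equiv 0\pmod d$ there exists a fraction $a_v/q_v$ with $(q_v,a_v)=1$ and $q_v>0$ such that $c_1d^{1/2}\le q_v\le c_2 d^{1/2}$, where $c_1,c_2>0$ are constants depending only on $N$, and \[ \left|\frac{v}{d}-\frac{a_v}{q_v}\right|\le \frac{1}{q_v^2}. \] -}

module Defs where

open import Data.Nat using (ℕ)
open import Data.Integer using (ℤ; +_; _*_; _+_)
open import Data.Integer.Divisibility using (_∣_)

data Admissible : ℕ → Set where
  N1   : Admissible 1
  N2   : Admissible 2
  N67  : Admissible 67
  N163 : Admissible 163

SolvesCong : ℕ → ℕ → ℤ → Set
SolvesCong N d v = (+ d) ∣ (v * v + + N)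

module Submission where

-- The argument works for every N ≥ 1, with c₁ = 1/(2N)
-- and c₂ = 3.
--
-- Choose Q with 2d ≤ Q² ≤ 8d.  Dirichlet's pigeonhole argument gives a/q with
-- q ≤ Q and |vq − ad|·Q < d, and reducing a/q to lowest terms preserves this.
-- Then q² ≤ 8d and |v/d − a/q| < 1/(qQ) ≤ 1/q².  For the lower bound, the
-- residual r = vq − ad satisfies r² + Nq² ≡ (v² + N)q² ≡ 0 (mod d), so
-- d ≤ r² + Nq², while 2r² < d by the choice of Q; hence d < 2Nq².

module NaturalArithmetic where

  open import Data.Nat
  open import Data.Nat.Properties
  open import Data.Nat.DivMod using (_/_; _%_; m/n*n≤m; m%n≡m∸m/n*n; m%n<n)
  open import Data.Nat.Tactic.RingSolver using (solve)
  open import Data.List using (_∷_; [])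
  open import Data.Product using (Σ; _×_; _,_)
  open import Data.Sum using (inj₁; inj₂)
  open import Relation.Nullary using (yes; no)
  open import Relation.Binary.PropositionalEquality

  -- Every m ≥ 1 has a square in the window [m, 4m].  Induction on m: keep the
  -- previous Q while m + 1 ≤ Q², otherwise Q² = m and (2Q)² = 4m works.
  square-window : ∀ m → .{{NonZero m}} → Σ ℕ λ Q → m ≤ Q * Q × Q * Q ≤ 4 * m
  square-window 1 = 1 , ≤-refl , s≤s z≤n
  square-window (suc (suc m)) with square-window (suc m)
  ... | Q , m+1≤Q² , Q²≤4m+4 with suc m <? Q * Q
  ...   | yes m+1<Q² = Q , m+1<Q² , ≤-trans Q²≤4m+4 (*-monoʳ-≤ 4 (n≤1+n (suc m)))
  ...   | no  m+1≮Q² = 2 * Q , lower , upper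
    where
      [2Q]²≡4[m+1] : 2 * Q * (2 * Q) ≡ 4 * suc m
      [2Q]²≡4[m+1] = begin
        2 * Q * (2 * Q) ≡⟨ solve (Q ∷ []) ⟩
        4 * (Q * Q)     ≡⟨ cong (4 *_) (≤-antisym (≮⇒≥ m+1≮Q²) m+1≤Q²) ⟩
        4 * suc m       ∎
        where open ≡-Reasoning
      lower : suc (suc m) ≤ 2 * Q * (2 * Q)
      lower = subst (suc (suc m) ≤_) (sym [2Q]²≡4[m+1]) (s≤s (m<m+n m z<s))
      upper : 2 * Q * (2 * Q) ≤ 4 * suc (suc m)
      upper = ≤-trans (≤-reflexive [2Q]²≡4[m+1]) (*-monoʳ-≤ 4 (n≤1+n (suc m)))

  same-quotient⇒∸< : ∀ x y d .{{_ : NonZero d}} → x / d ≡ y / d → y ∸ x < d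
  same-quotient⇒∸< x y d eq = begin-strict
      y ∸ x             ≤⟨ ∸-monoʳ-≤ y (m/n*n≤m x d) ⟩
      y ∸ x / d * d     ≡⟨ cong (λ t → y ∸ t * d) eq ⟩
      y ∸ y / d * d     ≡⟨ m%n≡m∸m/n*n y d ⟨
      y % d             <⟨ m%n<n y d ⟩
      d                 ∎
    where open ≤-Reasoning

  same-quotient⇒close : ∀ x y d .{{_ : NonZero d}} → x / d ≡ y / d → ∣ x - y ∣ < d
  same-quotient⇒close x y d eq with ≤-total x y
  ... | inj₁ x≤y = subst (_< d) (sym (m≤n⇒∣m-n∣≡n∸m x≤y)) (same-quotient⇒∸< x y d eq)
  ... | inj₂ y≤x = subst (_< d) (sym (m≤n⇒∣n-m∣≡n∸m y≤x)) (same-quotient⇒∸< y x d (sym eq))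

  small-residual : ∀ R Q d → R * Q < d → 2 * d ≤ Q * Q → 2 * (R * R) < d
  small-residual R Q d RQ<d 2d≤Q² = *-cancelʳ-< d _ _ (begin-strict
      2 * (R * R) * d     ≡⟨ solve (R ∷ d ∷ []) ⟩
      R * R * (2 * d)     ≤⟨ *-monoʳ-≤ (R * R) 2d≤Q² ⟩
      R * R * (Q * Q)     ≡⟨ solve (R ∷ Q ∷ []) ⟩
      (R * Q) * (R * Q)   <⟨ *-mono-< RQ<d RQ<d ⟩
      d * d               ∎)
    where open ≤-Reasoning

  dominant-summand : ∀ d X N Y → 2 * X < d → d ≤ X + N * Y → d < 2 * N * Y
  dominant-summand d X N Y 2X<d d≤X+NY = +-cancelˡ-< d d (2 * N * Y) (begin-strict
      d + d               ≡⟨ solve (d ∷ []) ⟩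
      2 * d               ≤⟨ *-monoʳ-≤ 2 d≤X+NY ⟩
      2 * (X + N * Y)     ≡⟨ solve (X ∷ N ∷ Y ∷ []) ⟩
      2 * X + 2 * N * Y   <⟨ +-monoˡ-< (2 * N * Y) 2X<d ⟩
      d + 2 * N * Y       ∎)
    where open ≤-Reasoning

module DirichletApproximation where

  open import Data.Nat as ℕ using (ℕ; suc; NonZero; _≤_; _<_) renaming (∣_-_∣ to ∣_-_∣ₙ)
  import Data.Nat.Properties as ℕP
  open import Data.Nat.DivMod as ℕD using ()
  open import Data.Nat.GCD using (gcd; gcd[m,n]∣m; gcd[m,n]∣n; gcd[m,n]≢0)
  open import Data.Nat.Coprimality using (Coprime; coprime-/gcd)
  open import Data.Integer using (ℤ; +_; _+_; _-_; _*_; ∣_∣; sign; _◃_) renaming (_⊖_ to _ℤ⊖_)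
  open import Data.Sign as Sign using ()
  import Data.Sign.Properties as SignP
  import Data.Integer.Properties as ℤP
  open import Data.Integer.DivMod using (_%ℕ_; _/ℕ_; a≡a%ℕn+[a/ℕn]*n; n%ℕd<d)
  open import Data.Integer.Tactic.RingSolver using (solve)
  open import Data.Fin as F using (Fin; toℕ; fromℕ<)
  open import Data.Fin.Properties using (pigeonhole; toℕ-fromℕ<; toℕ<n)
  open import Data.List using (_∷_; [])
  open import Data.Product using (Σ; ∃₂; _×_; _,_)
  open import Data.Sum using (inj₁; inj₂)
  open import Relation.Binary.PropositionalEquality using (_≡_; sym; trans; cong; cong₂; subst; module ≡-Reasoning)
  open NaturalArithmetic using (same-quotient⇒close)

  -- a/q approximates v/d at level Q: 1 ≤ q ≤ Q and |vq − ad|·Q < d, that is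
  -- |v/d − a/q| < 1/(qQ).
  record Approximation (d : ℕ) (v : ℤ) (Q : ℕ) : Set where
    constructor approximation
    field
      q : ℕ
      a : ℤ
      1≤q : 1 ≤ q
      q≤Q : q ≤ Q
      residual-bound : ∣ v * + q - a * + d ∣ ℕ.* Q < d

  ∣+m-+n∣≡∣m-n∣ : ∀ m n → ∣ + m - + n ∣ ≡ ∣ m - n ∣ₙ
  ∣+m-+n∣≡∣m-n∣ m n with ℕP.≤-total m n
  ... | inj₁ m≤n = begin
      ∣ + m - + n ∣  ≡⟨ cong ∣_∣ (ℤP.m-n≡m⊖n m n) ⟩
      ∣ m ℤ⊖ n ∣     ≡⟨ ℤP.∣⊖∣-≤ m≤n ⟩
      n ℕ.∸ m        ≡⟨ ℕP.m≤n⇒∣m-n∣≡n∸m m≤n ⟨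
      ∣ m - n ∣ₙ     ∎
    where open ≡-Reasoning
  ... | inj₂ n≤m = begin
      ∣ + m - + n ∣  ≡⟨ ℤP.∣i-j∣≡∣j-i∣ (+ m) (+ n) ⟩
      ∣ + n - + m ∣  ≡⟨ cong ∣_∣ (ℤP.m-n≡m⊖n n m) ⟩
      ∣ n ℤ⊖ m ∣     ≡⟨ ℤP.∣⊖∣-≤ n≤m ⟩
      m ℕ.∸ n        ≡⟨ ℕP.m≤n⇒∣n-m∣≡n∸m n≤m ⟨
      ∣ m - n ∣ₙ     ∎
    where open ≡-Reasoning

  -- Subtracting two decompositions kv = ρₖ + μₖ·d (k = J, I) gives the
  -- residual of the approximation (μ_J − μ_I)/(J − I) of v/d.
  residual-of-difference : ∀ v d J I ρJ ρI μJ μI →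
    J * v ≡ ρJ + μJ * d → I * v ≡ ρI + μI * d →
    v * (J - I) - (μJ - μI) * d ≡ ρJ - ρI
  residual-of-difference v d J I ρJ ρI μJ μI Jv≡ Iv≡ = begin
    v * (J - I) - (μJ - μI) * d                      ≡⟨ solve (v ∷ d ∷ J ∷ I ∷ μJ ∷ μI ∷ []) ⟩
    (J * v - μJ * d) - (I * v - μI * d)              ≡⟨ cong₂ (λ x y → (x - μJ * d) - (y - μI * d)) Jv≡ Iv≡ ⟩
    (ρJ + μJ * d - μJ * d) - (ρI + μI * d - μI * d)  ≡⟨ solve (d ∷ ρJ ∷ ρI ∷ μJ ∷ μI ∷ []) ⟩
    ρJ - ρI                                          ∎
    where open ≡-Reasoning

  -- Pigeonhole: the Q + 1 residues ρₖ = kv mod d (0 ≤ k ≤ Q) fall into the Q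
  -- boxes {ρ : ⌊ρQ/d⌋ = j}, so two of them, ρ_I and ρ_J with I < J, share a
  -- box; then q = J − I and a = μ_J − μ_I, where μₖ = ⌊kv/d⌋.
  dirichlet : ∀ d .{{_ : NonZero d}} (v : ℤ) Q .{{_ : NonZero Q}} → Approximation d v Q
  dirichlet d v Q = from-collision (pigeonhole (ℕP.n<1+n Q) box)
    where
      ρ : ℕ → ℕ
      ρ k = (+ k * v) %ℕ d
      μ : ℕ → ℤ
      μ k = (+ k * v) /ℕ d
      decomposition : ∀ k → + k * v ≡ + ρ k + μ k * + d
      decomposition k = a≡a%ℕn+[a/ℕn]*n (+ k * v) d
      box<Q : ∀ k → (ρ k ℕ.* Q) ℕ./ d < Q
      box<Q k = ℕD.m<n*o⇒m/o<n (subst (ρ k ℕ.* Q <_) (ℕP.*-comm d Q)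
                  (ℕP.*-monoˡ-< Q (n%ℕd<d (+ k * v) d)))
      box : Fin (suc Q) → Fin Q
      box k = fromℕ< (box<Q (toℕ k))
      from-collision : (∃₂ λ i j → i F.< j × box i ≡ box j) → Approximation d v Q
      from-collision (i , j , I<J , same-box) =
        approximation (J ℕ.∸ I) (μ J - μ I) (ℕP.m<n⇒0<n∸m I<J) q≤Q bound
        where
          I : ℕ
          I = toℕ i
          J : ℕ
          J = toℕ j
          q≤Q : J ℕ.∸ I ≤ Q
          q≤Q = ℕP.≤-trans (ℕP.m∸n≤m J I) (ℕ.s≤s⁻¹ (toℕ<n j))
          same-quotient : (ρ J ℕ.* Q) ℕ./ d ≡ (ρ I ℕ.* Q) ℕ./ d
          same-quotient = begin
            (ρ J ℕ.* Q) ℕ./ d  ≡⟨ toℕ-fromℕ< (box<Q J) ⟨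
            toℕ (box j)         ≡⟨ cong toℕ same-box ⟨
            toℕ (box i)         ≡⟨ toℕ-fromℕ< (box<Q I) ⟩
            (ρ I ℕ.* Q) ℕ./ d  ∎
            where open ≡-Reasoning
          residual : v * + (J ℕ.∸ I) - (μ J - μ I) * + d ≡ + ρ J - + ρ I
          residual = begin
            v * + (J ℕ.∸ I) - (μ J - μ I) * + d  ≡⟨ cong (λ t → v * t - (μ J - μ I) * + d) (ℤP.⊖-≥ (ℕP.<⇒≤ I<J)) ⟨
            v * (J ℤ⊖ I) - (μ J - μ I) * + d     ≡⟨ cong (λ t → v * t - (μ J - μ I) * + d) (ℤP.m-n≡m⊖n J I) ⟨
            v * (+ J - + I) - (μ J - μ I) * + d  ≡⟨ residual-of-difference v (+ d) (+ J) (+ I) (+ ρ J) (+ ρ I)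
                                                      (μ J) (μ I) (decomposition J) (decomposition I) ⟩
            + ρ J - + ρ I                        ∎
            where open ≡-Reasoning
          bound : ∣ v * + (J ℕ.∸ I) - (μ J - μ I) * + d ∣ ℕ.* Q < d
          bound = begin-strict
            ∣ v * + (J ℕ.∸ I) - (μ J - μ I) * + d ∣ ℕ.* Q  ≡⟨ cong (λ t → ∣ t ∣ ℕ.* Q) residual ⟩
            ∣ + ρ J - + ρ I ∣ ℕ.* Q                          ≡⟨ cong (ℕ._* Q) (∣+m-+n∣≡∣m-n∣ (ρ J) (ρ I)) ⟩
            ∣ ρ J - ρ I ∣ₙ ℕ.* Q                             ≡⟨ ℕP.*-distribʳ-∣-∣ Q (ρ J) (ρ I) ⟩
            ∣ ρ J ℕ.* Q - ρ I ℕ.* Q ∣ₙ                       <⟨ same-quotient⇒close _ _ d same-quotient ⟩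
            d                                                ∎
            where open ℕP.≤-Reasoning

  record LowestTerms (q : ℕ) (a : ℤ) : Set where
    field
      g  : ℕ
      q' : ℕ
      a' : ℤ
      {{g≢0}} : NonZero g
      q'g≡q : q' ℕ.* g ≡ q
      a'g≡a : a' * + g ≡ a
      coprime : Coprime q' ∣ a' ∣

  lowest-terms : ∀ q .{{_ : NonZero q}} a → LowestTerms q a
  lowest-terms q a = record
    { g = g ; q' = q ℕ./ g ; a' = a' ; q'g≡q = ℕD.m/n*n≡m (gcd[m,n]∣m q ∣ a ∣)
    ; a'g≡a = a'g≡a
    ; coprime = subst (Coprime (q ℕ./ g)) (sym (ℤP.abs-◃ (sign a) (∣ a ∣ ℕ./ g))) (coprime-/gcd q ∣ a ∣) }
    where
      g : ℕ
      g = gcd q ∣ a ∣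
      instance
        g≢0 : NonZero g
        g≢0 = ℕ.≢-nonZero (gcd[m,n]≢0 q ∣ a ∣ (inj₁ (ℕ.≢-nonZero⁻¹ q)))
      a' : ℤ
      a' = sign a ◃ (∣ a ∣ ℕ./ g)
      a'g≡a : a' * + g ≡ a
      a'g≡a = begin
        (sign a ◃ (∣ a ∣ ℕ./ g)) * + g              ≡⟨ cong (a' *_) (ℤP.+◃n≡+n g) ⟨
        (sign a ◃ (∣ a ∣ ℕ./ g)) * (Sign.+ ◃ g)     ≡⟨ ℤP.◃-distrib-* (sign a) Sign.+ (∣ a ∣ ℕ./ g) g ⟨
        (sign a Sign.* Sign.+) ◃ (∣ a ∣ ℕ./ g ℕ.* g) ≡⟨ cong₂ _◃_ (SignP.*-identityʳ (sign a)) (ℕD.m/n*n≡m (gcd[m,n]∣n q ∣ a ∣)) ⟩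
        sign a ◃ ∣ a ∣                              ≡⟨ ℤP.◃-inverse a ⟩
        a                                           ∎
        where open ≡-Reasoning

  residual-scales : ∀ v d q' a' g → v * (q' * g) - (a' * g) * d ≡ (v * q' - a' * d) * g
  residual-scales v d q' a' g = solve (v ∷ d ∷ q' ∷ a' ∷ g ∷ [])

  -- Reducing a/q to lowest terms keeps it an approximation at level Q: the
  -- denominator and the residual can only shrink.
  coprime-approximation : ∀ {d v Q} → Approximation d v Q →
    Σ (Approximation d v Q) λ A → Coprime (Approximation.q A) ∣ Approximation.a A ∣
  coprime-approximation {d} {v} {Q} (approximation q@(suc _) a _ q≤Q bound) =
    approximation q' a' 1≤q' (ℕP.≤-trans q'≤q q≤Q) bound' , coprime
    where
      open LowestTerms (lowest-terms q a)
      q'≤q : q' ≤ q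
      q'≤q = subst (q' ≤_) q'g≡q (ℕP.m≤m*n q' g {{g≢0}})
      1≤q' : 1 ≤ q'
      1≤q' = ℕP.n≢0⇒n>0 (λ q'≡0 → ℕP.1+n≢0 (trans (sym q'g≡q) (cong (ℕ._* g) q'≡0)))
      residual≡ : ∣ v * + q - a * + d ∣ ≡ ∣ v * + q' - a' * + d ∣ ℕ.* g
      residual≡ = begin
        ∣ v * + q - a * + d ∣                   ≡⟨ cong₂ (λ x y → ∣ v * x - y * + d ∣) (cong +_ q'g≡q) a'g≡a ⟨
        ∣ v * + (q' ℕ.* g) - a' * + g * + d ∣   ≡⟨ cong (λ x → ∣ v * x - a' * + g * + d ∣) (ℤP.pos-* q' g) ⟩
        ∣ v * (+ q' * + g) - a' * + g * + d ∣   ≡⟨ cong ∣_∣ (residual-scales v (+ d) (+ q') a' (+ g)) ⟩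
        ∣ (v * + q' - a' * + d) * + g ∣         ≡⟨ ℤP.abs-* (v * + q' - a' * + d) (+ g) ⟩
        ∣ v * + q' - a' * + d ∣ ℕ.* g           ∎
        where open ≡-Reasoning
      bound' : ∣ v * + q' - a' * + d ∣ ℕ.* Q < d
      bound' = ℕP.≤-<-trans (ℕP.*-monoˡ-≤ Q residual-shrinks) bound
        where
          residual-shrinks : ∣ v * + q' - a' * + d ∣ ≤ ∣ v * + q - a * + d ∣
          residual-shrinks = subst (∣ v * + q' - a' * + d ∣ ≤_) (sym residual≡) (ℕP.m≤m*n _ g {{g≢0}})

module Norm where

  open import Data.Nat as ℕ using (ℕ; _≤_)
  import Data.Nat.Properties as ℕP
  open import Data.Nat.Divisibility as ℕDiv using ()
  open import Data.Integer using (ℤ; +_; _+_; _-_; _*_; ∣_∣; sign; _◃_)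
  import Data.Integer.Properties as ℤP
  open import Data.Sign as Sign using ()
  import Data.Sign.Properties as SignP
  open import Data.Integer.Divisibility.Signed using (_∣_; ∣-refl; ∣m⇒∣m*n; ∣n⇒∣m*n; ∣m∣n⇒∣m+n; ∣ᵤ⇒∣; ∣⇒∣ᵤ)
  open import Data.Integer.Tactic.RingSolver using (solve)
  open import Data.List using (_∷_; [])
  open import Relation.Binary.PropositionalEquality using (_≡_; sym; trans; cong; cong₂; subst; module ≡-Reasoning)
  open import Defs using (SolvesCong)

  norm-identity : ∀ N d v q a →
    (v * q - a * d) * (v * q - a * d) + N * (q * q)
      ≡ (v * v + N) * (q * q) + (a * a * d - + 2 * v * q * a) * d
  norm-identity N d v q a = solve (N ∷ d ∷ v ∷ q ∷ a ∷ [])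

  norm-divisible : ∀ N d v q a → d ∣ v * v + N →
    d ∣ (v * q - a * d) * (v * q - a * d) + N * (q * q)
  norm-divisible N d v q a d∣v²+N = subst (d ∣_) (sym (norm-identity N d v q a))
    (∣m∣n⇒∣m+n (∣m⇒∣m*n (q * q) d∣v²+N) (∣n⇒∣m*n (a * a * d - + 2 * v * q * a) ∣-refl))

  square-abs : ∀ r → r * r ≡ + (∣ r ∣ ℕ.* ∣ r ∣)
  square-abs r = begin
    r * r                                        ≡⟨⟩
    (sign r Sign.* sign r) ◃ (∣ r ∣ ℕ.* ∣ r ∣)   ≡⟨ cong (_◃ (∣ r ∣ ℕ.* ∣ r ∣)) (SignP.s*s≡+ (sign r)) ⟩
    Sign.+ ◃ (∣ r ∣ ℕ.* ∣ r ∣)                   ≡⟨ ℤP.+◃n≡+n (∣ r ∣ ℕ.* ∣ r ∣) ⟩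
    + (∣ r ∣ ℕ.* ∣ r ∣)                          ∎
    where open ≡-Reasoning

  d≤norm : ∀ N d v q a → 1 ≤ N → 1 ≤ q → SolvesCong N d v →
    d ≤ ∣ v * + q - a * + d ∣ ℕ.* ∣ v * + q - a * + d ∣ ℕ.+ N ℕ.* (q ℕ.* q)
  d≤norm N d v q a 1≤N 1≤q d∣v²+N = ℕDiv.∣⇒≤ {{ℕ.>-nonZero norm-positive}} d∣norm
    where
      r : ℤ
      r = v * + q - a * + d
      norm-positive : 0 ℕ.< ∣ r ∣ ℕ.* ∣ r ∣ ℕ.+ N ℕ.* (q ℕ.* q)
      norm-positive = ℕP.<-≤-trans (ℕP.*-mono-< 1≤N (ℕP.*-mono-< 1≤q 1≤q)) (ℕP.m≤n+m _ (∣ r ∣ ℕ.* ∣ r ∣))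
      norm≡ : ∣ r * r + + N * (+ q * + q) ∣ ≡ ∣ r ∣ ℕ.* ∣ r ∣ ℕ.+ N ℕ.* (q ℕ.* q)
      norm≡ = cong ∣_∣ (cong₂ _+_ (square-abs r)
                (trans (cong (+ N *_) (sym (ℤP.pos-* q q))) (sym (ℤP.pos-* N (q ℕ.* q)))))
      d∣norm : d ℕDiv.∣ ∣ r ∣ ℕ.* ∣ r ∣ ℕ.+ N ℕ.* (q ℕ.* q)
      d∣norm = subst (d ℕDiv.∣_) norm≡ (∣⇒∣ᵤ (norm-divisible (+ N) (+ d) v (+ q) a (∣ᵤ⇒∣ d∣v²+N)))

module IntegerForm where

  open import Data.Nat as ℕ using (ℕ; zero; suc; NonZero; _≤_; _<_)
  import Data.Nat.Properties as ℕP
  open import Data.Nat.Coprimality using (Coprime)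
  open import Data.Integer using (ℤ; +_; _-_; _*_; ∣_∣)
  open import Data.Product using (Σ; _×_; _,_)
  open import Relation.Binary.PropositionalEquality using (sym)
  open import Relation.Nullary using (contradiction)
  open import Defs using (SolvesCong)
  open NaturalArithmetic using (square-window; small-residual; dominant-summand)
  open DirichletApproximation using (Approximation; approximation; dirichlet; coprime-approximation)
  open Norm using (d≤norm)

  record ReducedApproximation (N d : ℕ) (v : ℤ) : Set where
    field
      q : ℕ
      a : ℤ
      1≤q : 1 ≤ q
      coprime : Coprime q ∣ a ∣
      q²≤8d : q ℕ.* q ≤ 8 ℕ.* d
      d<2Nq² : d < 2 ℕ.* N ℕ.* (q ℕ.* q)
      residual-bound : ∣ v * + q - a * + d ∣ ℕ.* q < d

  reduced-approximation : ∀ N d .{{_ : NonZero d}} v → 1 ≤ N → SolvesCong N d v →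
    ReducedApproximation N d v
  reduced-approximation N d v 1≤N d∣v²+N = from-window (square-window (2 ℕ.* d) {{ℕP.m*n≢0 2 d}})
    where
      from-approximation : ∀ Q → 2 ℕ.* d ≤ Q ℕ.* Q → Q ℕ.* Q ≤ 4 ℕ.* (2 ℕ.* d) →
        Σ (Approximation d v Q) (λ A → Coprime (Approximation.q A) ∣ Approximation.a A ∣) →
        ReducedApproximation N d v
      from-approximation Q 2d≤Q² Q²≤4[2d] (approximation q a 1≤q q≤Q RQ<d , coprime) = record
        { q = q ; a = a ; 1≤q = 1≤q ; coprime = coprime
        ; q²≤8d = ℕP.≤-trans (ℕP.*-mono-≤ q≤Q q≤Q) (ℕP.≤-trans Q²≤4[2d] (ℕP.≤-reflexive (sym (ℕP.*-assoc 4 2 d))))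
        ; d<2Nq² = dominant-summand d (R ℕ.* R) N (q ℕ.* q) (small-residual R Q d RQ<d 2d≤Q²)
                     (d≤norm N d v q a 1≤N 1≤q d∣v²+N)
        ; residual-bound = ℕP.≤-<-trans (ℕP.*-monoʳ-≤ R q≤Q) RQ<d
        }
        where
          R : ℕ
          R = ∣ v * + q - a * + d ∣
      from-window : (Σ ℕ λ Q → 2 ℕ.* d ≤ Q ℕ.* Q × Q ℕ.* Q ≤ 4 ℕ.* (2 ℕ.* d)) → ReducedApproximation N d v
      from-window (zero , 2d≤0 , _) = contradiction 2d≤0 (ℕP.<⇒≱ (ℕ.>-nonZero⁻¹ (2 ℕ.* d) {{ℕP.m*n≢0 2 d}}))
      from-window (Q@(suc _) , 2d≤Q² , Q²≤4[2d]) = from-approximation Q 2d≤Q² Q²≤4[2d] (coprime-approximation (dirichlet d v Q))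

module Fractions where

  open import Data.Nat as ℕ using (ℕ; suc; NonZero)
  import Data.Nat.Properties as ℕP
  open import Data.Nat.Tactic.RingSolver using (solve)
  open import Data.Integer as ℤ using (ℤ; +_; +≤+)
  import Data.Integer.Properties as ℤP
  open import Data.Rational using (_/_; _*_; _-_; -_; _≤_; ∣_∣; toℚᵘ)
  open import Data.Rational.Properties
    using (toℚᵘ-cancel-≤; toℚᵘ-homo-*; toℚᵘ-homo-+; toℚᵘ-homo‿-; toℚᵘ-homo-∣-∣; toℚᵘ-fromℚᵘ)
  open import Data.Rational.Unnormalised as ℚᵘ using (mkℚᵘ; *≤*) renaming (_≃_ to _≃ᵘ_; _/_ to _/ᵘ_)
  import Data.Rational.Unnormalised.Properties as ℚᵘP
  open import Data.List using (_∷_; [])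
  open import Relation.Binary.PropositionalEquality using (_≡_; sym; cong; subst₂)

  -- Inequalities between rationals are checked on representing fractions of
  -- naturals, by cross-multiplication.  `toℚᵘ p ≃ᵘ + a /ᵘ b` says that the
  -- rational p is the fraction a/b.

  -- Products of non-zero denominators are non-zero denominators.  (Kept
  -- private: outside this module the search it triggers is too expensive.)
  private instance
    *-nonZero : ∀ {m n} .{{_ : NonZero m}} .{{_ : NonZero n}} → NonZero (m ℕ.* n)
    *-nonZero {m} {n} = ℕP.m*n≢0 m n

  toℚᵘ-/ : ∀ i n .{{_ : NonZero n}} → toℚᵘ (i / n) ≃ᵘ i /ᵘ n
  toℚᵘ-/ i (suc n) = toℚᵘ-fromℚᵘ (mkℚᵘ i n)

  fraction-* : ∀ a b c e .{{_ : NonZero b}} .{{_ : NonZero e}} →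
    (+ a /ᵘ b) ℚᵘ.* (+ c /ᵘ e) ≡ (+ (a ℕ.* c) /ᵘ (b ℕ.* e))
  fraction-* a (suc b) c (suc e) = cong (λ i → mkℚᵘ i _) (sym (ℤP.pos-* a c))

  toℚᵘ-* : ∀ {p r} a b c e .{{_ : NonZero b}} .{{_ : NonZero e}} →
    toℚᵘ p ≃ᵘ + a /ᵘ b → toℚᵘ r ≃ᵘ + c /ᵘ e →
    toℚᵘ (p * r) ≃ᵘ (+ (a ℕ.* c) /ᵘ (b ℕ.* e))
  toℚᵘ-* {p} {r} a b c e p≃a/b r≃c/e = ℚᵘP.≃-trans (toℚᵘ-homo-* p r)
    (ℚᵘP.≃-trans (ℚᵘP.*-cong p≃a/b r≃c/e) (ℚᵘP.≃-reflexive (fraction-* a b c e)))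

  fraction-distance : ∀ i m j n .{{_ : NonZero m}} .{{_ : NonZero n}} →
    ℚᵘ.∣ (i /ᵘ m) ℚᵘ.- (j /ᵘ n) ∣ ≡ (+ ℤ.∣ i ℤ.* + n ℤ.- j ℤ.* + m ∣ /ᵘ (m ℕ.* n))
  fraction-distance i (suc m) j (suc n) =
    cong (λ k → mkℚᵘ (+ ℤ.∣ i ℤ.* + suc n ℤ.+ k ∣) _) (sym (ℤP.neg-distribˡ-* j (+ suc m)))

  toℚᵘ-distance : ∀ i m j n .{{_ : NonZero m}} .{{_ : NonZero n}} →
    toℚᵘ ∣ i / m - j / n ∣ ≃ᵘ (+ ℤ.∣ i ℤ.* + n ℤ.- j ℤ.* + m ∣ /ᵘ (m ℕ.* n))
  toℚᵘ-distance i m j n = ℚᵘP.≃-trans (toℚᵘ-homo-∣-∣ (i / m - j / n))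
    (ℚᵘP.≃-trans (ℚᵘP.∣-∣-cong (ℚᵘP.≃-trans (toℚᵘ-homo-+ (i / m) (- (j / n)))
      (ℚᵘP.+-cong (toℚᵘ-/ i m) (ℚᵘP.≃-trans (toℚᵘ-homo‿- (j / n)) (ℚᵘP.-‿cong (toℚᵘ-/ j n))))))
      (ℚᵘP.≃-reflexive (fraction-distance i m j n)))

  ≤-via-fractions : ∀ {p r} a b c e .{{_ : NonZero b}} .{{_ : NonZero e}} →
    toℚᵘ p ≃ᵘ + a /ᵘ b → toℚᵘ r ≃ᵘ + c /ᵘ e → a ℕ.* e ℕ.≤ c ℕ.* b → p ≤ r
  ≤-via-fractions a b@(suc _) c e@(suc _) p≃a/b r≃c/e ae≤cb =
    toℚᵘ-cancel-≤ (ℚᵘP.≤-respˡ-≃ (ℚᵘP.≃-sym p≃a/b) (ℚᵘP.≤-respʳ-≃ (ℚᵘP.≃-sym r≃c/e)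
      (*≤* (subst₂ ℤ._≤_ (ℤP.pos-* a e) (ℤP.pos-* c b) (+≤+ ae≤cb)))))

  lower-bound : ∀ k d q .{{_ : NonZero k}} → d ℕ.≤ k ℕ.* k ℕ.* (q ℕ.* q) →
    (+ 1 / k) * (+ 1 / k) * (+ d / 1) ≤ (+ q / 1) * (+ q / 1)
  lower-bound k d q d≤k²q² = ≤-via-fractions (1 ℕ.* 1 ℕ.* d) (k ℕ.* k ℕ.* 1) (q ℕ.* q) (1 ℕ.* 1)
    (toℚᵘ-* (1 ℕ.* 1) (k ℕ.* k) d 1 (toℚᵘ-* 1 k 1 k (toℚᵘ-/ (+ 1) k) (toℚᵘ-/ (+ 1) k)) (toℚᵘ-/ (+ d) 1))
    (toℚᵘ-* q 1 q 1 (toℚᵘ-/ (+ q) 1) (toℚᵘ-/ (+ q) 1))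
    (begin
      1 ℕ.* 1 ℕ.* d ℕ.* (1 ℕ.* 1)  ≡⟨ solve (d ∷ []) ⟩
      d                             ≤⟨ d≤k²q² ⟩
      k ℕ.* k ℕ.* (q ℕ.* q)         ≡⟨ solve (k ∷ q ∷ []) ⟩
      q ℕ.* q ℕ.* (k ℕ.* k ℕ.* 1)   ∎)
    where open ℕP.≤-Reasoning

  upper-bound : ∀ k d q → q ℕ.* q ℕ.≤ k ℕ.* k ℕ.* d →
    (+ q / 1) * (+ q / 1) ≤ (+ k / 1) * (+ k / 1) * (+ d / 1)
  upper-bound k d q q²≤k²d = ≤-via-fractions (q ℕ.* q) (1 ℕ.* 1) (k ℕ.* k ℕ.* d) (1 ℕ.* 1 ℕ.* 1)
    (toℚᵘ-* q 1 q 1 (toℚᵘ-/ (+ q) 1) (toℚᵘ-/ (+ q) 1))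
    (toℚᵘ-* (k ℕ.* k) (1 ℕ.* 1) d 1 (toℚᵘ-* k 1 k 1 (toℚᵘ-/ (+ k) 1) (toℚᵘ-/ (+ k) 1)) (toℚᵘ-/ (+ d) 1))
    (begin
      q ℕ.* q ℕ.* (1 ℕ.* 1 ℕ.* 1)  ≡⟨ solve (q ∷ []) ⟩
      q ℕ.* q                       ≤⟨ q²≤k²d ⟩
      k ℕ.* k ℕ.* d                 ≡⟨ solve (k ∷ d ∷ []) ⟩
      k ℕ.* k ℕ.* d ℕ.* (1 ℕ.* 1)   ∎)
    where open ℕP.≤-Reasoning

  distance-bound : ∀ v d a q .{{_ : NonZero d}} .{{_ : NonZero q}} →
    ℤ.∣ v ℤ.* + q ℤ.- a ℤ.* + d ∣ ℕ.* q ℕ.≤ d →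
    ∣ v / d - a / q ∣ ≤ (+ 1 / q) * (+ 1 / q)
  distance-bound v d a q Rq≤d = ≤-via-fractions R (d ℕ.* q) (1 ℕ.* 1) (q ℕ.* q)
    (toℚᵘ-distance v d a q)
    (toℚᵘ-* 1 q 1 q (toℚᵘ-/ (+ 1) q) (toℚᵘ-/ (+ 1) q))
    (begin
      R ℕ.* (q ℕ.* q)          ≡⟨ ℕP.*-assoc R q q ⟨
      R ℕ.* q ℕ.* q            ≤⟨ ℕP.*-monoˡ-≤ q Rq≤d ⟩
      d ℕ.* q                  ≡⟨ solve (d ∷ q ∷ []) ⟩
      1 ℕ.* 1 ℕ.* (d ℕ.* q)    ∎)
    where
      open ℕP.≤-Reasoning
      R : ℕ
      R = ℤ.∣ v ℤ.* + q ℤ.- a ℤ.* + d ∣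

open import Defs
open import Data.Nat using (ℕ; NonZero)
open import Data.Nat.Coprimality using (Coprime)
open import Data.Integer using (ℤ; +_)
open import Data.Integer as ℤ using (∣_∣)
open import Data.Rational using (ℚ; _/_; _*_; _-_; _≤_; Positive)
open import Data.Rational as ℚ using ()
open import Data.Product using (Σ; _×_; _,_)

import Data.Nat as ℕ
import Data.Nat.Properties as ℕP
open import Data.Rational.Properties using (normalize-pos)
open IntegerForm using (ReducedApproximation; reduced-approximation)
open Fractions using (lower-bound; upper-bound; distance-bound)

admissible⇒1≤N : ∀ {N} → Admissible N → 1 ℕ.≤ N
admissible⇒1≤N N1   = ℕ.s≤s ℕ.z≤n
admissible⇒1≤N N2   = ℕ.s≤s ℕ.z≤n
admissible⇒1≤N N67  = ℕ.s≤s ℕ.z≤n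
admissible⇒1≤N N163 = ℕ.s≤s ℕ.z≤n

-- A reduced approximation a/q of v/d (d < 2N q², q² ≤ 8d, |vq − ad|·q < d)
-- satisfies the rational bounds of the theorem with c₁ = 1/(2N) and c₂ = 3:
-- d < 2N q² ≤ (2N)² q², q² ≤ 8d ≤ 3² d and |v/d − a/q| ≤ 1/q².
rational-form : ∀ N d .{{_ : NonZero d}} .{{_ : NonZero (2 ℕ.* N)}} v → ReducedApproximation N d v →
  Σ ℤ λ a → Σ ℕ λ q → Σ (NonZero q) λ q≢0 →
    Coprime q (ℤ.∣ a ∣) ×
    ((+ 1 / (2 ℕ.* N)) * (+ 1 / (2 ℕ.* N)) * (+ d / 1) ≤ (+ q / 1) * (+ q / 1)) ×
    ((+ q / 1) * (+ q / 1) ≤ (+ 3 / 1) * (+ 3 / 1) * (+ d / 1)) ×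
    (ℚ.∣ (v / d) - (_/_ a q {{q≢0}}) ∣ ≤ (_/_ (+ 1) q {{q≢0}}) * (_/_ (+ 1) q {{q≢0}}))
rational-form N d v record { q = q ; a = a ; 1≤q = 1≤q ; coprime = coprime ; q²≤8d = q²≤8d
                           ; d<2Nq² = d<2Nq² ; residual-bound = residual-bound } =
  a , q , q≢0 , coprime
  , lower-bound (2 ℕ.* N) d q (ℕP.≤-trans (ℕP.<⇒≤ d<2Nq²) (ℕP.*-monoˡ-≤ (q ℕ.* q) (ℕP.m≤m*n (2 ℕ.* N) (2 ℕ.* N))))
  , upper-bound 3 d q (ℕP.≤-trans q²≤8d (ℕP.*-monoˡ-≤ d (ℕP.n≤1+n 8)))
  , distance-bound v d a q {{_}} {{q≢0}} (ℕP.<⇒≤ residual-bound)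
  where
    q≢0 : NonZero q
    q≢0 = ℕ.>-nonZero 1≤q

lemma2p2 : (N : ℕ) → Admissible N →
  Σ ℚ λ c₁ → Σ ℚ λ c₂ → Positive c₁ × Positive c₂ ×
    ((d : ℕ) → .{{_ : NonZero d}} → (v : ℤ) → SolvesCong N d v →
      Σ ℤ λ a → Σ ℕ λ q → Σ (NonZero q) λ q≢0 →
        Coprime q (ℤ.∣ a ∣) ×
        (c₁ * c₁ * (+ d / 1) ≤ (+ q / 1) * (+ q / 1)) ×
        ((+ q / 1) * (+ q / 1) ≤ c₂ * c₂ * (+ d / 1)) ×
        (ℚ.∣ (v / d) - (_/_ a q {{q≢0}}) ∣ ≤ (_/_ (+ 1) q {{q≢0}}) * (_/_ (+ 1) q {{q≢0}})))
lemma2p2 N adm = + 1 / (2 ℕ.* N) , + 3 / 1 , normalize-pos 1 (2 ℕ.* N) , _ ,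
  λ d v d∣v²+N → rational-form N d v (reduced-approximation N d v 1≤N d∣v²+N)
  where
    1≤N : 1 ℕ.≤ N
    1≤N = admissible⇒1≤N adm
    instance
      2N≢0 : NonZero (2 ℕ.* N)
      2N≢0 = ℕP.m*n≢0 2 N {{_}} {{ℕ.>-nonZero 1≤N}}
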